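{- Let $G$ be a graph. If the dual distance $2$-VC dimension of $G$ is at least $t$, then $K_t$ is a minor of $G$. Equivalently: if there exist $t$ pairs $(v_1,r_1),\ldots,(v_t,r_t)$ with $v_i\in V(G)$ and integers $r_i\geq 0$ whose balls $B(v_i,r_i)$ are pairwise distinct hyperedges, such that for every $1\leq i<j\leq t$ there is a vertex $x_{ij}$ with $d(x_{ij},v_i)\leq r_i$, $d(x_{ij},v_j)\leq r_j$ and $d(x_{ij},v_m)>r_m$ for all $m\notin\{i,j\}$, then $K_t$ is a minor of $G$.
   Context: Graphs are finite and simple. The ball $B(v,r)=\{u: d(u,v)\leq r\}$. The distance hypergraph $\mathcal{H}(G)$ has vertex set $V(G)$ and as hyperedges all balls $B(v,r)$. Its dual has the balls as vertices and, for each vertex $x$ of $G$, a hyperedge consisting of the balls containing $x$. In a hypergraph, a $2$-shattered set is a set $X$ of vertices such that for every $X'\subseteq X$ with $|X'|=2$ some hyperedge $e$ satisfies $e\cap X=X'$; the $2$-VC dimension is the maximum size of a $2$-shattered set. The dual distance $2$-VC dimension of $G$ is the $2$-VC dimension of the dual of $\mathcal{H}(G)$. -}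

module Defs where

open import Data.Nat using (ℕ; zero; suc; _≤_)
open import Data.Fin using (Fin)
open import Data.Bool using (Bool; true; false)
open import Data.Unit using (⊤)
open import Data.Product using (Σ; ∃; ∃₂; _×_; _,_)
open import Data.Sum using (_⊎_)
open import Relation.Nullary using (¬_)
open import Relation.Binary.PropositionalEquality using (_≡_; _≢_)

record Graph (n : ℕ) : Set where
  field
    adj    : Fin n → Fin n → Bool
    sym    : ∀ u v → adj u v ≡ adj v u
    irrefl : ∀ v → adj v v ≡ false

Adj : ∀ {n} → Graph n → Fin n → Fin n → Set
Adj G u v = Graph.adj G u v ≡ true

data WalkIn {n : ℕ} (G : Graph n) (P : Fin n → Set) : Fin n → Fin n → ℕ → Set where
  here : ∀ {v} → P v → WalkIn G P v v 0
  step : ∀ {u w v k} → P u → Adj G u w → WalkIn G P w v k → WalkIn G P u v (suc k)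

Walk : ∀ {n} → Graph n → Fin n → Fin n → ℕ → Set
Walk G = WalkIn G (λ _ → ⊤)

-- d(u,v) ≤ r  (distance in G; infinite if disconnected)
DistLe : ∀ {n} → Graph n → Fin n → Fin n → ℕ → Set
DistLe G u v r = ∃ λ k → k ≤ r × Walk G u v k

InBall : ∀ {n} → Graph n → Fin n × ℕ → Fin n → Set
InBall G (v , r) u = DistLe G u v r

SameBall : ∀ {n} → Graph n → Fin n × ℕ → Fin n × ℕ → Set
SameBall G b b' = ∀ u → (InBall G b u → InBall G b' u) × (InBall G b' u → InBall G b u)

-- There is a 2-shattered set of size t in the dual of the distance
-- hypergraph: t pairwise distinct balls B(v_i,r_i) such that for every
-- pair i ≠ j some vertex x lies in exactly the balls i and j among them.
DualDist2Shattered : ∀ {n} → Graph n → ℕ → Set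
DualDist2Shattered {n} G t =
  Σ (Fin t → Fin n × ℕ) λ c →
    (∀ i j → i ≢ j → ¬ SameBall G (c i) (c j)) ×
    (∀ i j → i ≢ j → ∃ λ (x : Fin n) →
       ∀ m → (InBall G (c m) x → (m ≡ i ⊎ m ≡ j)) × ((m ≡ i ⊎ m ≡ j) → InBall G (c m) x))

record CompleteMinor {n : ℕ} (t : ℕ) (G : Graph n) : Set₁ where
  field
    branch    : Fin t → Fin n → Set
    nonempty  : ∀ i → ∃ λ v → branch i v
    disjoint  : ∀ i j v → branch i v → branch j v → i ≡ j
    connected : ∀ i u v → branch i u → branch i v → ∃ λ k → WalkIn G (branch i) u v k
    joined    : ∀ i j → i ≢ j → ∃₂ λ u v → branch i u × branch j v × Adj G u v

module Submission where

-- Let Bᵢ = B(vᵢ, rᵢ) be the t balls and xᵢⱼ the pair points. Split V(G) into weighted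
-- Voronoi cells: u lies in cell i when d(u, vᵢ) − rᵢ is smallest, ties broken by index.
-- Cells are disjoint, and a shortest walk from a vertex of cell i to vᵢ stays in cell i.
-- For t ≥ 3 no ball contains another (xᵢₖ ∈ Bᵢ ∖ Bₘ for a third index k), which gives
-- d(vᵢ, vₘ) > rₘ − rᵢ, so vᵢ lies in its own cell. For a vertex w on a walk of length at
-- most rᵢ from xᵢⱼ to vᵢ, xᵢⱼ ∉ Bₘ makes every m ∉ {i, j} lose to i at w, so w lies in
-- cell i or cell j. Hence vⱼ and vᵢ are joined through xᵢⱼ by a walk inside these two
-- cells, which must contain an edge between them. For t ≤ 2 a clique suffices, and two
-- distinct balls sharing a vertex force an edge.

open import Defs
open import Data.Nat using (ℕ; zero; suc; _+_; _≤_; _<_; z≤n; s≤s)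
open import Data.Nat.Properties
open import Data.Nat.Induction using (<-rec)
open import Data.Nat.Tactic.RingSolver using (solve-∀)
open import Data.Fin as Fin using (Fin; zero; suc)
import Data.Fin.Properties as Fin
open import Data.Bool using (true)
import Data.Bool.Properties as Bool
open import Data.Unit using (tt)
open import Data.Empty using (⊥-elim)
open import Data.Product using (∃; ∃₂; _×_; _,_; proj₁; proj₂)
open import Data.Sum using (_⊎_; inj₁; inj₂; [_,_]; swap)
open import Data.Vec using ([]; _∷_; lookup)
open import Function using (_∘_)
open import Relation.Binary using (tri<; tri≈; tri>)
open import Relation.Binary.PropositionalEquality using (_≡_; _≢_; refl; sym; trans; subst; subst₂)
open import Relation.Nullary using (¬_; yes; no)
open import Relation.Nullary.Decidable using (Dec; map′; _×-dec_; decidable-stable)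
open import Relation.Unary using (Decidable; _∪_)

module _ {n : ℕ} (G : Graph n) where

  Adj-sym : ∀ {u w} → Adj G u w → Adj G w u
  Adj-sym {u} {w} = trans (Graph.sym G w u)

  Adj-irrefl : ∀ {u} → ¬ Adj G u u
  Adj-irrefl {u} uu with trans (sym uu) (Graph.irrefl G u)
  ... | ()

module _ {n : ℕ} {G : Graph n} where

  first : ∀ {P u v k} → WalkIn G P u v k → P u
  first (here p)     = p
  first (step p _ _) = p

  map : ∀ {P Q : Fin n → Set} → (∀ {u} → P u → Q u) → ∀ {u v k} → WalkIn G P u v k → WalkIn G Q u v k
  map f (here p)         = here (f p)
  map f (step p uw rest) = step (f p) uw (map f rest)

  _++_ : ∀ {P u w v k l} → WalkIn G P u w k → WalkIn G P w v l → WalkIn G P u v (k + l)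
  here _         ++ q = q
  step p uw rest ++ q = step p uw (rest ++ q)

  snoc : ∀ {P u w v k} → WalkIn G P u w k → Adj G w v → P v → WalkIn G P u v (suc k)
  snoc (here p)         wv q = step p wv (here q)
  snoc (step p uw rest) wv q = step p uw (snoc rest wv q)

  reverse : ∀ {P u v k} → WalkIn G P u v k → WalkIn G P v u k
  reverse (here p)         = here p
  reverse (step p uw rest) = snoc (reverse rest) (Adj-sym G uw) p

  crossing-edge : ∀ {A B : Fin n → Set} → (∀ u → A u → ¬ B u) →
                  ∀ {s e k} → WalkIn G (A ∪ B) s e k → A s → B e →
                  ∃₂ λ u w → A u × B w × Adj G u w
  crossing-edge disj (here _) as be = ⊥-elim (disj _ as be)
  crossing-edge disj (step _ sw rest) as be with first rest
  ... | inj₁ aw = crossing-edge disj rest aw be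
  ... | inj₂ bw = _ , _ , as , bw , sw

walk? : ∀ {n} (G : Graph n) → ∀ u v k → Dec (Walk G u v k)
walk? G u v zero    = map′ (λ { refl → here tt }) (λ { (here _) → refl }) (u Fin.≟ v)
walk? G u v (suc k) =
  map′ (λ (w , uw , rest) → step tt uw rest) (λ { (step _ uw rest) → _ , uw , rest })
       (Fin.any? λ w → (Graph.adj G u w Bool.≟ true) ×-dec walk? G w v k)

Least : (ℕ → Set) → ℕ → Set
Least P d = P d × (∀ {l} → P l → d ≤ l)

least : ∀ {P : ℕ → Set} → Decidable P → ∀ {a} → P a → ∃ (Least P)
least {P} P? {a} = <-rec (λ a → P a → ∃ (Least P)) descend a
  where
    descend : ∀ a → (∀ {b} → b < a → P b → ∃ (Least P)) → P a → ∃ (Least P)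
    descend a smaller pa with anyUpTo? P? a
    ... | yes (b , b<a , pb) = smaller b<a pb
    ... | no none            = a , pa , λ {l} pl → ≮⇒≥ λ l<a → none (l , l<a , pl)

shortest : ∀ {n} (G : Graph n) {u v a} → Walk G u v a → ∃ (Least (Walk G u v))
shortest G {u} {v} = least (walk? G u v)

+-<-detour : ∀ {d a z} s w {p} → d ≤ a → z < s + w → s + a ≤ p → d + z < w + p
+-<-detour {d} {a} {z} s w {p} d≤a z<s+w s+a≤p = begin-strict
  d + z       <⟨ +-mono-≤-< d≤a z<s+w ⟩
  a + (s + w) ≡⟨ regroup a s w ⟩
  s + a + w   ≤⟨ +-monoˡ-≤ w s+a≤p ⟩
  p + w       ≡⟨ +-comm p w ⟩
  w + p       ∎
  where
    open ≤-Reasoning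
    regroup : ∀ a s w → a + (s + w) ≡ s + a + w
    regroup = solve-∀

+-<-transfer : ∀ a b p q z w → a + p ≤ b + q → b + z < w + p → a + z < w + q
+-<-transfer a b p q z w ≤-ineq <-ineq =
  +-cancelʳ-< (b + p) (a + z) (w + q)
    (subst₂ _<_ (left a p b z) (right b q w p) (+-mono-≤-< ≤-ineq <-ineq))
  where
    left : ∀ a p b z → a + p + (b + z) ≡ a + z + (b + p)
    left = solve-∀
    right : ∀ b q w p → b + q + (w + p) ≡ w + q + (b + p)
    right = solve-∀

PairsShattered : ∀ {n t} → Graph n → (Fin t → Fin n × ℕ) → Set
PairsShattered {n} G c = ∀ i j → i ≢ j → ∃ λ (x : Fin n) →
  ∀ m → (InBall G (c m) x → m ≡ i ⊎ m ≡ j) × (m ≡ i ⊎ m ≡ j → InBall G (c m) x)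

BallAntichain : ∀ {n t} → Graph n → (Fin t → Fin n × ℕ) → Set
BallAntichain {n} G c = ∀ i m → i ≢ m → ∃ λ (x : Fin n) → InBall G (c i) x × ¬ InBall G (c m) x

module WeightedVoronoi {n t : ℕ} (G : Graph n) (c : Fin t → Fin n × ℕ) where

  centre : Fin t → Fin n
  centre i = proj₁ (c i)

  radius : Fin t → ℕ
  radius i = proj₂ (c i)

  -- For walks of lengths k and l to the centres of i and m: k − rᵢ < l − rₘ, ties broken by index.
  Beats : Fin t → Fin t → ℕ → ℕ → Set
  Beats i m k l = k + radius m < l + radius i ⊎ (k + radius m ≡ l + radius i × i Fin.< m)

  BeatsAll : Fin t → Fin n → ℕ → Set
  BeatsAll i u k = ∀ m → m ≢ i → ∀ {l} → Walk G u (centre m) l → Beats i m k l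

  Cell : Fin t → Fin n → Set
  Cell i u = ∃ λ k → Walk G u (centre i) k × BeatsAll i u k

  Beats-pred : ∀ {i m k l} → Beats i m (suc k) (suc l) → Beats i m k l
  Beats-pred (inj₁ (s≤s lt))   = inj₁ lt
  Beats-pred (inj₂ (eq , i<m)) = inj₂ (suc-injective eq , i<m)

  Beats-asym : ∀ {i j k l} → Beats i j k l → ¬ Beats j i l k
  Beats-asym (inj₁ lt)      (inj₁ gt)      = <-asym lt gt
  Beats-asym (inj₁ lt)      (inj₂ (eq , _)) = <-irrefl (sym eq) lt
  Beats-asym (inj₂ (eq , _)) (inj₁ gt)      = <-irrefl (sym eq) gt
  Beats-asym (inj₂ (_ , i<j)) (inj₂ (_ , j<i)) = Fin.<-asym i<j j<i

  Beats-monoʳ : ∀ {i m k l l′} → l ≤ l′ → Beats i m k l → Beats i m k l′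
  Beats-monoʳ l≤l′ (inj₁ lt) = inj₁ (<-≤-trans lt (+-monoˡ-≤ _ l≤l′))
  Beats-monoʳ {i} {l′ = l′} l≤l′ (inj₂ (eq , i<m)) with m≤n⇒m<n∨m≡n (+-monoˡ-≤ (radius i) l≤l′)
  ... | inj₁ lt  = inj₁ (subst (_< l′ + radius i) (sym eq) lt)
  ... | inj₂ eq′ = inj₂ (trans eq eq′ , i<m)

  Beats⇒≤ : ∀ {i j k l} → Beats i j k l → k + radius j ≤ l + radius i
  Beats⇒≤ = [ <⇒≤ , ≤-reflexive ∘ proj₁ ]

  Beats-total : ∀ {i j} → i ≢ j → ∀ k l → Beats i j k l ⊎ Beats j i l k
  Beats-total {i} {j} i≢j k l with <-cmp (k + radius j) (l + radius i)
  ... | tri< lt _ _ = inj₁ (inj₁ lt)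
  ... | tri> _ _ gt = inj₂ (inj₁ gt)
  ... | tri≈ _ eq _ with Fin.<-cmp i j
  ...   | tri< i<j _ _ = inj₁ (inj₂ (eq , i<j))
  ...   | tri≈ _ i≡j _ = ⊥-elim (i≢j i≡j)
  ...   | tri> _ _ j<i = inj₂ (inj₂ (sym eq , j<i))

  Cell-disjoint : ∀ {i j} → i ≢ j → ∀ u → Cell i u → ¬ Cell j u
  Cell-disjoint i≢j u (_ , uvᵢ , beatsᵢ) (_ , uvⱼ , beatsⱼ) =
    Beats-asym (beatsᵢ _ (i≢j ∘ sym) uvⱼ) (beatsⱼ _ i≢j uvᵢ)

  -- One step towards centre i shortens that walk and lengthens any other by at most one.
  walk-to-centre : ∀ {i u k} → Walk G u (centre i) k → BeatsAll i u k → WalkIn G (Cell i) u (centre i) k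
  walk-to-centre (here tt) beats = here (0 , here tt , beats)
  walk-to-centre (step tt uw rest) beats =
    step (_ , step tt uw rest , beats) uw
         (walk-to-centre rest λ m m≢i wvₘ → Beats-pred (beats m m≢i (step tt uw wvₘ)))

  Cell-walk : ∀ {i u} (p : Cell i u) → WalkIn G (Cell i) u (centre i) (proj₁ p)
  Cell-walk (_ , uvᵢ , beats) = walk-to-centre uvᵢ beats

  Cell-intro : ∀ {i j w k} → Walk G w (centre i) k →
               (∀ {l} → Walk G w (centre j) l → Beats i j k l) →
               (∀ m → m ≢ i → m ≢ j → ∀ {l} → Walk G w (centre m) l → k + radius m < l + radius i) →
               Cell i w
  Cell-intro {i} {j} {w} {k} wvᵢ beats-j beats-others = k , wvᵢ , beats
    where
      beats : ∀ m → m ≢ i → ∀ {l} → Walk G w (centre m) l → Beats i m k l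
      beats m m≢i with m Fin.≟ j
      ... | yes refl = beats-j
      ... | no m≢j   = inj₁ ∘ beats-others m m≢i m≢j

  Cell-between : ∀ {i j w a b} → i ≢ j → Walk G w (centre i) a → Walk G w (centre j) b →
                 (∀ {d} → d ≤ a → ∀ m → m ≢ i → m ≢ j → ∀ {l} → Walk G w (centre m) l →
                    d + radius m < l + radius i) →
                 (Cell i ∪ Cell j) w
  Cell-between {i} {j} i≢j wvᵢ wvⱼ others-lose with shortest G wvᵢ | shortest G wvⱼ
  ... | dᵢ , shortᵢ , minᵢ | dⱼ , shortⱼ , minⱼ with Beats-total i≢j dᵢ dⱼ
  ... | inj₁ i-wins = inj₁ (Cell-intro shortᵢ (λ q → Beats-monoʳ (minⱼ q) i-wins) (others-lose (minᵢ wvᵢ)))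
  ... | inj₂ j-wins = inj₂ (Cell-intro shortⱼ (λ q → Beats-monoʳ (minᵢ q) j-wins)
          λ m m≢j m≢i {l} wvₘ → +-<-transfer dⱼ dᵢ (radius i) (radius j) (radius m) l
                                  (Beats⇒≤ j-wins) (others-lose (minᵢ wvᵢ) m m≢i m≢j wvₘ))

  module _ {i j x b} (i≢j : i ≢ j) (only-i-j : ∀ m → InBall G (c m) x → m ≡ i ⊎ m ≡ j)
           (xvⱼ : Walk G x (centre j) b) where

    -- Since x ∉ Bₘ, a centre m ∉ {i, j} is at distance more than rₘ − s from w.
    near-x : ∀ {w s a} → Walk G x w s → Walk G w (centre i) a → s + a ≤ radius i → (Cell i ∪ Cell j) w
    near-x {w} {s} {a} xw wvᵢ s+a≤rᵢ = Cell-between i≢j wvᵢ (reverse xw ++ xvⱼ) others-lose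
      where
        others-lose : ∀ {d} → d ≤ a → ∀ m → m ≢ i → m ≢ j → ∀ {l} → Walk G w (centre m) l →
                      d + radius m < l + radius i
        others-lose d≤a m m≢i m≢j {l} wvₘ = +-<-detour s l d≤a rₘ<s+l s+a≤rᵢ
          where
            rₘ<s+l : radius m < s + l
            rₘ<s+l = ≰⇒> λ s+l≤rₘ → [ m≢i , m≢j ] (only-i-j m (s + l , s+l≤rₘ , xw ++ wvₘ))

    walk-in-cells : ∀ {w s a} → Walk G x w s → Walk G w (centre i) a → s + a ≤ radius i →
                    WalkIn G (Cell i ∪ Cell j) w (centre i) a
    walk-in-cells xw (here tt) s+a≤rᵢ = here (near-x xw (here tt) s+a≤rᵢ)
    walk-in-cells {s = s} xw (step tt wu rest) s+a≤rᵢ =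
      step (near-x xw (step tt wu rest) s+a≤rᵢ) wu
           (walk-in-cells (snoc xw wu tt) rest (subst (_≤ radius i) (+-suc s _) s+a≤rᵢ))

  centre∈Cell : BallAntichain G c → ∀ i → Cell i (centre i)
  centre∈Cell antichain i = 0 , here tt , λ m m≢i vᵢvₘ → inj₁ (≰⇒> (centres-far m m≢i vᵢvₘ))
    where
      centres-far : ∀ m → m ≢ i → ∀ {l} → Walk G (centre i) (centre m) l → ¬ l + radius i ≤ radius m
      centres-far m m≢i {l} vᵢvₘ l+rᵢ≤rₘ with antichain i m (m≢i ∘ sym)
      ... | x , (a , a≤rᵢ , xvᵢ) , x∉Bₘ =
        x∉Bₘ (a + l , ≤-trans (+-monoˡ-≤ l a≤rᵢ) (subst (_≤ radius m) (+-comm l (radius i)) l+rᵢ≤rₘ) , xvᵢ ++ vᵢvₘ)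

  Cells-adjacent : BallAntichain G c → PairsShattered G c →
                   ∀ i j → i ≢ j → ∃₂ λ u w → Cell i u × Cell j w × Adj G u w
  Cells-adjacent antichain shattered i j i≢j with shattered i j i≢j
  ... | x , ball-of with proj₂ (ball-of i) (inj₁ refl) | proj₂ (ball-of j) (inj₂ refl)
  ... | a , a≤rᵢ , xvᵢ | b , b≤rⱼ , xvⱼ =
    crossing-edge (Cell-disjoint i≢j) (reverse to-i ++ map swap to-j)
                  (centre∈Cell antichain i) (centre∈Cell antichain j)
    where
      to-i : WalkIn G (Cell i ∪ Cell j) x (centre i) a
      to-i = walk-in-cells i≢j (proj₁ ∘ ball-of) xvⱼ (here tt) xvᵢ a≤rᵢ
      to-j : WalkIn G (Cell j ∪ Cell i) x (centre j) b
      to-j = walk-in-cells (i≢j ∘ sym) (λ m → swap ∘ proj₁ (ball-of m)) xvᵢ (here tt) xvⱼ b≤rⱼ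

  minor : BallAntichain G c → PairsShattered G c → CompleteMinor t G
  minor antichain shattered = record
    { branch    = Cell
    ; nonempty  = λ i → centre i , centre∈Cell antichain i
    ; disjoint  = λ i j u p q → decidable-stable (i Fin.≟ j) λ i≢j → Cell-disjoint i≢j u p q
    ; connected = λ i u w p q → _ , Cell-walk p ++ reverse (Cell-walk q)
    ; joined    = Cells-adjacent antichain shattered
    }

clique-minor : ∀ {n t} (G : Graph n) (f : Fin t → Fin n) → (∀ i j → i ≢ j → Adj G (f i) (f j)) →
               CompleteMinor t G
clique-minor G f adjacent = record
  { branch    = λ i u → u ≡ f i
  ; nonempty  = λ i → f i , refl
  ; disjoint  = λ { i j _ refl fᵢ≡fⱼ → decidable-stable (i Fin.≟ j) λ i≢j →
                    Adj-irrefl G (subst (Adj G (f i)) (sym fᵢ≡fⱼ) (adjacent i j i≢j)) }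
  ; connected = λ { _ _ _ refl refl → 0 , here refl }
  ; joined    = λ i j i≢j → f i , f j , refl , refl , adjacent i j i≢j
  }

edge-minor : ∀ {n} (G : Graph n) {u w} → Adj G u w → CompleteMinor 2 G
edge-minor G {u} {w} uw = clique-minor G (lookup (u ∷ w ∷ [])) adjacent
  where
    adjacent : ∀ i j → i ≢ j → Adj G (lookup (u ∷ w ∷ []) i) (lookup (u ∷ w ∷ []) j)
    adjacent zero       zero       0≢0 = ⊥-elim (0≢0 refl)
    adjacent zero       (suc zero) _   = uw
    adjacent (suc zero) zero       _   = Adj-sym G uw
    adjacent (suc zero) (suc zero) 1≢1 = ⊥-elim (1≢1 refl)

module _ {n : ℕ} (G : Graph n) where

  edgeless-walk : (∀ u w → ¬ Adj G u w) → ∀ {u v k} → Walk G u v k → u ≡ v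
  edgeless-walk _       (here _)      = refl
  edgeless-walk no-edge (step _ uw _) = ⊥-elim (no-edge _ _ uw)

  centre∈ball : ∀ {u v} r → u ≡ v → InBall G (v , r) u
  centre∈ball _ refl = 0 , z≤n , here tt

  -- Without edges every ball is the singleton of its centre.
  shared-point⇒edge : ∀ {b b′ x} → ¬ SameBall G b b′ → InBall G b x → InBall G b′ x → ∃₂ λ u w → Adj G u w
  shared-point⇒edge {v , r} {v′ , r′} distinct (_ , _ , xv) (_ , _ , xv′)
    with Fin.any? (λ u → Fin.any? λ w → Graph.adj G u w Bool.≟ true)
  ... | yes edge    = edge
  ... | no no-edges = ⊥-elim (distinct λ u →
          (λ (_ , _ , uv)  → centre∈ball r′ (trans (edgeless uv) v≡v′))
        , (λ (_ , _ , uv′) → centre∈ball r (trans (edgeless uv′) (sym v≡v′))))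
    where
      edgeless : ∀ {u v k} → Walk G u v k → u ≡ v
      edgeless = edgeless-walk λ u w uw → no-edges (u , w , uw)
      v≡v′ : v ≡ v′
      v≡v′ = trans (sym (edgeless xv)) (edgeless xv′)

third-index : ∀ {t} (i j : Fin (3 + t)) → ∃ λ k → k ≢ i × k ≢ j
third-index zero          zero          = suc zero , (λ ()) , (λ ())
third-index zero          (suc zero)    = suc (suc zero) , (λ ()) , (λ ())
third-index zero          (suc (suc _)) = suc zero , (λ ()) , (λ ())
third-index (suc zero)    zero          = suc (suc zero) , (λ ()) , (λ ())
third-index (suc (suc _)) zero          = suc zero , (λ ()) , (λ ())
third-index (suc _)       (suc _)       = zero , (λ ()) , (λ ())

shattered⇒antichain : ∀ {n t} (G : Graph n) (c : Fin (3 + t) → Fin n × ℕ) →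
                      PairsShattered G c → BallAntichain G c
shattered⇒antichain G c shattered i m i≢m with third-index i m
... | k , k≢i , k≢m with shattered i k (k≢i ∘ sym)
... | x , ball-of = x , proj₂ (ball-of i) (inj₁ refl) , [ i≢m ∘ sym , k≢m ∘ sym ] ∘ proj₁ (ball-of m)

theorem6 : ∀ {n : ℕ} (G : Graph n) (t : ℕ) → DualDist2Shattered G t → CompleteMinor t G
theorem6 G 0 _       = clique-minor G (λ ()) (λ ())
theorem6 G 1 (c , _) = clique-minor G (λ _ → proj₁ (c zero)) λ { zero zero 0≢0 → ⊥-elim (0≢0 refl) }
theorem6 G 2 (c , distinct , shattered) with shattered zero (suc zero) (λ ())
... | _ , ball-of with shared-point⇒edge G (distinct zero (suc zero) (λ ()))
                         (proj₂ (ball-of zero) (inj₁ refl)) (proj₂ (ball-of (suc zero)) (inj₂ refl))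
... | _ , _ , uw = edge-minor G uw
theorem6 G (suc (suc (suc t))) (c , _ , shattered) =
  WeightedVoronoi.minor G c (shattered⇒antichain G c shattered) shattered
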